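{- Let $G$ be a graph of order $n$ and let $\overline{G}$ be its complement. Then $\mathrm{LIF}(G) + \mathrm{LIF}(\overline{G}) \leq n + 4$, and this bound is sharp, i.e., there exist graphs for which equality holds.
   Context: All graphs are finite and simple. A linear forest is a forest every connected component of which is a path. $\mathrm{LIF}(G)$ denotes the maximum number of vertices of an induced subgraph of $G$ that is a linear forest. -}

module Defs where

open import Data.Nat using (ℕ; _≤_)
open import Data.Bool using (Bool; true; false; not; _∧_)
open import Data.Fin using (Fin; _≟_)
open import Data.List using (List; []; _∷_; concat; length)
open import Data.List.Membership.Propositional using (_∈_)
open import Data.List.Relation.Unary.Any using (Any)
open import Data.List.Relation.Unary.Unique.Propositional using (Unique)
open import Data.Product using (Σ; _×_; ∃; _,_)
open import Data.Sum using (_⊎_)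
open import Function.Bundles using (_⇔_)
open import Relation.Nullary using (does; yes; no)
open import Relation.Binary.PropositionalEquality using (_≡_; refl; sym; cong; cong₂)

record Graph (n : ℕ) : Set where
  field
    adj       : Fin n → Fin n → Bool
    adj-sym   : ∀ i j → adj i j ≡ adj j i
    adj-irrefl : ∀ i → adj i i ≡ false
open Graph public

private
  neq : ∀ {n} → Fin n → Fin n → Bool
  neq i j = not (does (i ≟ j))

  neq-sym : ∀ {n} (i j : Fin n) → neq i j ≡ neq j i
  neq-sym i j with i ≟ j | j ≟ i
  ... | yes _ | yes _ = refl
  ... | no _  | no _  = refl
  ... | yes p | no ¬q = Data.Empty.⊥-elim (¬q (sym p)) where import Data.Empty
  ... | no ¬p | yes q = Data.Empty.⊥-elim (¬p (sym q)) where import Data.Empty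

  neq-refl : ∀ {n} (i : Fin n) → neq i i ≡ false
  neq-refl i with i ≟ i
  ... | yes _ = refl
  ... | no ¬p = Data.Empty.⊥-elim (¬p refl) where import Data.Empty

complement : ∀ {n} → Graph n → Graph n
complement G = record
  { adj        = λ i j → not (adj G i j) ∧ neq i j
  ; adj-sym    = λ i j → cong₂ (λ a b → not a ∧ b) (adj-sym G i j) (neq-sym i j)
  ; adj-irrefl = λ i → lemma (not (adj G i i)) (neq-refl i)
  }
  where
  lemma : ∀ (a : Bool) {b} → b ≡ false → (a ∧ b) ≡ false
  lemma true  refl = refl
  lemma false _    = refl

data Consecutive {A : Set} : List A → A → A → Set where
  here  : ∀ {x y xs} → Consecutive (x ∷ y ∷ xs) x y
  there : ∀ {z x y xs} → Consecutive xs x y → Consecutive (z ∷ xs) x y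

-- A list of vertex sequences P (the paths) witnesses that the vertex set
-- S = concat P induces a linear forest in G: the vertices of S are pairwise
-- distinct, and two vertices of S are adjacent in G exactly when they are
-- consecutive on one of the paths. So G[S] is the disjoint union of the paths
-- in P, i.e. a forest each component of which is a path.
InducesLinearForest : ∀ {n} → Graph n → List (List (Fin n)) → Set
InducesLinearForest G P =
  Unique (concat P) ×
  (∀ u v → u ∈ concat P → v ∈ concat P →
     (adj G u v ≡ true) ⇔ Any (λ p → Consecutive p u v ⊎ Consecutive p v u) P)

IsLIF : ∀ {n} → Graph n → ℕ → Set
IsLIF G k =
  (∃ λ P → InducesLinearForest G P × length (concat P) ≡ k) ×
  (∀ P → InducesLinearForest G P → length (concat P) ≤ k)

-- Let A and B be the vertex sets of induced linear forests of G and of its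
-- complement. Then |A| + |B| = |A ∪ B| + |A ∩ B| ≤ n + |A ∩ B|, and |A ∩ B| ≤ 4:
-- list each forest path by path and let m be the vertex of A ∩ B that comes last
-- in the listing of A. Every other w ∈ A ∩ B is adjacent to m in G or in the
-- complement, so w is a neighbour of m on a path of one of the two forests; on
-- the G-side it must precede m. Hence w is one of at most three vertices: the
-- predecessor of m in A, or the predecessor or successor of m in B. The path P₄
-- is self-complementary and attains the bound.
module Submission where

open import Defs
open import Data.Bool using (true; false; _∨_)
import Data.Bool.Properties as Bool
open import Data.Empty using (⊥-elim)
open import Data.Fin as Fin using (Fin; #_; toℕ)
open import Data.Fin.Patterns using (0F; 1F; 2F; 3F)
import Data.Fin.Properties as Finₚ
open import Data.List using (List; []; _∷_; _++_; concat; filter; length; lookup)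
open import Data.List.Extrema.Nat using (argmax; argmax-sel; f[⊥]≤f[argmax]; f[xs]≤f[argmax])
open import Data.List.Membership.Propositional using (_∈_)
open import Data.List.Membership.Propositional.Properties using (∈-lookup; ∈-filter⁻)
import Data.List.Membership.DecPropositional as DecMembership
import Data.List.Relation.Unary.Unique.DecPropositional as DecUnique
open import Data.List.Relation.Binary.Subset.Propositional using (_⊆_)
open import Data.List.Relation.Unary.All as All using (_∷_)
open import Data.List.Relation.Unary.AllPairs using (_∷_)
open import Data.List.Relation.Unary.Any as Any using (Any; here; there)
open import Data.List.Relation.Unary.Any.Properties using (Any-⊎⁻)
open import Data.List.Relation.Unary.Unique.Propositional using (Unique)
open import Data.List.Relation.Unary.Unique.Propositional.Properties using (filter⁺; ++⁺)
open import Data.List.Properties using (length-++)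
open import Data.Nat using (ℕ; zero; suc; _+_; _≤_; _≡ᵇ_; _≤?_; z≤n)
open import Data.Nat.Properties
  using (suc-injective; 0≢1+n; ≤-reflexive; ≤-trans; <-irrefl; ≰⇒>; <⇒≱; +-comm; +-assoc; +-suc; +-monoʳ-≤; module ≤-Reasoning)
open import Data.Product using (_×_; Σ; ∃; _,_; proj₁; proj₂; uncurry)
open import Data.Sum as Sum using (_⊎_; inj₁; inj₂)
open import Function.Bundles using (_⇔_; mk⇔; Equivalence)
open import Relation.Binary.Definitions using (DecidableEquality)
open import Relation.Unary using (Decidable)
open import Relation.Unary.Properties using (∁?)
open import Relation.Binary.PropositionalEquality
  using (_≡_; _≢_; refl; sym; trans; cong; subst; module ≡-Reasoning)
open import Relation.Nullary using (Dec; yes; no; _×-dec_; _⊎-dec_; _→-dec_)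
open import Relation.Nullary.Decidable using (map′; from-yes)

module _ {A : Set} where

  lookup-injective : ∀ {xs : List A} → Unique xs → ∀ i j → lookup xs i ≡ lookup xs j → i ≡ j
  lookup-injective (_ ∷ _) Fin.zero Fin.zero _ = refl
  lookup-injective (x∉ ∷ _) Fin.zero (Fin.suc j) eq = ⊥-elim (All.lookup x∉ (∈-lookup j) eq)
  lookup-injective (x∉ ∷ _) (Fin.suc i) Fin.zero eq = ⊥-elim (All.lookup x∉ (∈-lookup i) (sym eq))
  lookup-injective (_ ∷ xs!) (Fin.suc i) (Fin.suc j) eq = cong Fin.suc (lookup-injective xs! i j eq)

  module _ {k : ℕ} (R : Fin k → A → Set) where

    Unique⇒length≤#classes : ∀ {xs} → Unique xs →
      (∀ {x} → x ∈ xs → ∃ λ i → R i x) →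
      (∀ i {x y} → x ∈ xs → y ∈ xs → R i x → R i y → x ≡ y) →
      length xs ≤ k
    Unique⇒length≤#classes {xs} xs! classify single with length xs ≤? k
    ... | yes ≤k = ≤k
    ... | no ≰k with Finₚ.pigeonhole (≰⇒> ≰k) (λ i → proj₁ (classify (∈-lookup i)))
    ... | i , j , i<j , same = ⊥-elim (<-irrefl (cong toℕ i≡j) i<j)
      where
      i≡j : i ≡ j
      i≡j = lookup-injective xs! i j
        (single _ (∈-lookup i) (∈-lookup j)
          (proj₂ (classify (∈-lookup i)))
          (subst (λ c → R c (lookup xs j)) (sym same) (proj₂ (classify (∈-lookup j)))))

Unique⇒length≤ : ∀ {n} {xs : List (Fin n)} → Unique xs → length xs ≤ n
Unique⇒length≤ xs! = Unique⇒length≤#classes (λ i x → x ≡ i) xs! (λ {x} _ → x , refl)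
  (λ _ _ _ x≡i y≡i → trans x≡i (sym y≡i))

module _ {A : Set} where

  Consecutive⇒∈ˡ : ∀ {xs : List A} {u v} → Consecutive xs u v → u ∈ xs
  Consecutive⇒∈ˡ here      = here refl
  Consecutive⇒∈ˡ (there c) = there (Consecutive⇒∈ˡ c)

  Consecutive⇒∈ʳ : ∀ {xs : List A} {u v} → Consecutive xs u v → v ∈ xs
  Consecutive⇒∈ʳ here      = there (here refl)
  Consecutive⇒∈ʳ (there c) = there (Consecutive⇒∈ʳ c)

  Consecutive-++⁺ˡ : ∀ {xs : List A} ys {u v} → Consecutive xs u v → Consecutive (xs ++ ys) u v
  Consecutive-++⁺ˡ ys here      = here
  Consecutive-++⁺ˡ ys (there c) = there (Consecutive-++⁺ˡ ys c)

  Consecutive-++⁺ʳ : ∀ (xs : List A) {ys u v} → Consecutive ys u v → Consecutive (xs ++ ys) u v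
  Consecutive-++⁺ʳ []       c = c
  Consecutive-++⁺ʳ (x ∷ xs) c = there (Consecutive-++⁺ʳ xs c)

  Consecutive-concat⁺ : ∀ {P : List (List A)} {u v} → Any (λ p → Consecutive p u v) P →
                        Consecutive (concat P) u v
  Consecutive-concat⁺ {p ∷ _} (here c)  = Consecutive-++⁺ˡ _ c
  Consecutive-concat⁺ {p ∷ _} (there c) = Consecutive-++⁺ʳ p (Consecutive-concat⁺ c)

  module _ (_≟_ : DecidableEquality A) where

    consecutive? : ∀ xs x y → Dec (Consecutive xs x y)
    consecutive? []               x y = no λ ()
    consecutive? (a ∷ [])         x y = no λ { (there ()) }
    consecutive? (a ∷ xs@(b ∷ _)) x y =
      map′ from to ((a ≟ x ×-dec b ≟ y) ⊎-dec consecutive? xs x y)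
      where
      from : (a ≡ x × b ≡ y) ⊎ Consecutive xs x y → Consecutive (a ∷ xs) x y
      from (inj₁ (refl , refl)) = here
      from (inj₂ c)             = there c
      to : Consecutive (a ∷ xs) x y → (a ≡ x × b ≡ y) ⊎ Consecutive xs x y
      to here      = inj₁ (refl , refl)
      to (there c) = inj₂ c

    position : A → List A → ℕ
    position x []       = 0
    position x (y ∷ ys) with x ≟ y
    ... | yes _ = 0
    ... | no  _ = suc (position x ys)

    position-here : ∀ x xs → position x (x ∷ xs) ≡ 0
    position-here x xs with x ≟ x
    ... | yes _  = refl
    ... | no x≢x = ⊥-elim (x≢x refl)

    position-there : ∀ {x y} xs → x ≢ y → position x (y ∷ xs) ≡ suc (position x xs)
    position-there {x} {y} xs x≢y with x ≟ y
    ... | yes x≡y = ⊥-elim (x≢y x≡y)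
    ... | no  _   = refl

    position-injective : ∀ {x y} xs → x ∈ xs → y ∈ xs → position x xs ≡ position y xs → x ≡ y
    position-injective {x} {y} (z ∷ zs) x∈ y∈ eq with x ≟ z | y ≟ z | x∈ | y∈
    ... | yes x≡z | yes y≡z | _        | _        = trans x≡z (sym y≡z)
    ... | yes _   | no  _   | _        | _        = ⊥-elim (0≢1+n eq)
    ... | no  _   | yes _   | _        | _        = ⊥-elim (0≢1+n (sym eq))
    ... | no  x≢z | no  _   | here x≡z | _        = ⊥-elim (x≢z x≡z)
    ... | no  _   | no  y≢z | _        | here y≡z = ⊥-elim (y≢z y≡z)
    ... | no  _   | no  _   | there x∈′ | there y∈′ =
      position-injective zs x∈′ y∈′ (suc-injective eq)

    position-consecutive : ∀ {xs u v} → Unique xs → Consecutive xs u v →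
                           position v xs ≡ suc (position u xs)
    position-consecutive {u ∷ v ∷ xs} ((u≢v ∷ _) ∷ _) here = begin
      position v (u ∷ v ∷ xs)   ≡⟨ position-there (v ∷ xs) (λ v≡u → u≢v (sym v≡u)) ⟩
      suc (position v (v ∷ xs)) ≡⟨ cong suc (position-here v xs) ⟩
      1                         ≡⟨ cong suc (sym (position-here u (v ∷ xs))) ⟩
      suc (position u (u ∷ v ∷ xs)) ∎
      where open ≡-Reasoning
    position-consecutive {z ∷ xs} {u} {v} (z∉ ∷ xs!) (there c) = begin
      position v (z ∷ xs)       ≡⟨ position-there xs (z≢ (Consecutive⇒∈ʳ c)) ⟩
      suc (position v xs)       ≡⟨ cong suc (position-consecutive xs! c) ⟩
      suc (suc (position u xs)) ≡⟨ cong suc (sym (position-there xs (z≢ (Consecutive⇒∈ˡ c)))) ⟩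
      suc (position u (z ∷ xs)) ∎
      where
      open ≡-Reasoning
      z≢ : ∀ {w} → w ∈ xs → w ≢ z
      z≢ w∈ w≡z = All.lookup z∉ w∈ (sym w≡z)

module _ {A : Set} {P : A → Set} (P? : Decidable P) where

  length-filter+filter∁ : ∀ xs → length (filter P? xs) + length (filter (∁? P?) xs) ≡ length xs
  length-filter+filter∁ []       = refl
  length-filter+filter∁ (x ∷ xs) with P? x
  ... | yes _ = cong suc (length-filter+filter∁ xs)
  ... | no  _ = trans (+-suc _ _) (cong suc (length-filter+filter∁ xs))

module _ {n : ℕ} where

  open DecMembership (Finₚ._≟_ {n}) using (_∈?_)

  length+length≤n+common : ∀ {xs ys : List (Fin n)} → Unique xs → Unique ys →
                           length xs + length ys ≤ n + length (filter (_∈? ys) xs)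
  length+length≤n+common {xs} {ys} xs! ys! = begin
    length xs + length ys                            ≡⟨ cong (_+ length ys) (sym (length-filter+filter∁ (_∈? ys) xs)) ⟩
    length common + length rest + length ys          ≡⟨ +-assoc (length common) _ _ ⟩
    length common + (length rest + length ys)        ≡⟨ cong (length common +_) (sym (length-++ rest)) ⟩
    length common + length (rest ++ ys)              ≤⟨ +-monoʳ-≤ (length common) (Unique⇒length≤ rest++ys!) ⟩
    length common + n                                ≡⟨ +-comm (length common) n ⟩
    n + length common                                ∎
    where
    open ≤-Reasoning
    common rest : List (Fin n)
    common = filter (_∈? ys) xs
    rest   = filter (∁? (_∈? ys)) xs
    rest++ys! : Unique (rest ++ ys)
    rest++ys! = ++⁺ (filter⁺ _ xs!) ys! λ (x∈rest , x∈ys) → proj₂ (∈-filter⁻ (∁? (_∈? ys)) {xs = xs} x∈rest) x∈ys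

  complement-adj : ∀ (G : Graph n) {u v} → adj G u v ≡ false → u ≢ v → adj (complement G) u v ≡ true
  complement-adj G {u} {v} ¬uv u≢v rewrite ¬uv with u Finₚ.≟ v
  ... | yes u≡v = ⊥-elim (u≢v u≡v)
  ... | no  _   = refl

  pos : Fin n → List (Fin n) → ℕ
  pos = position Finₚ._≟_

  adj⇒pos-adjacent : ∀ (G : Graph n) {P} → InducesLinearForest G P →
    ∀ {u v} → u ∈ concat P → v ∈ concat P → adj G u v ≡ true →
    pos v (concat P) ≡ suc (pos u (concat P)) ⊎ pos u (concat P) ≡ suc (pos v (concat P))
  adj⇒pos-adjacent G (S! , adj⇔consecutive) u∈ v∈ uv =
    Sum.map (position-consecutive _ S!) (position-consecutive _ S!)
      (Sum.map Consecutive-concat⁺ Consecutive-concat⁺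
        (Any-⊎⁻ (Equivalence.to (adj⇔consecutive _ _ u∈ v∈) uv)))

  module _ (G : Graph n) {P Q}
           (P-forest : InducesLinearForest G P) (Q-forest : InducesLinearForest (complement G) Q) where

    private
      A B : List (Fin n)
      A = concat P
      B = concat Q

    common-length≤4 : ∀ {C} → Unique C → C ⊆ A → C ⊆ B → length C ≤ 4
    common-length≤4 {[]}     _  _   _   = z≤n
    common-length≤4 {c ∷ cs} C! C⊆A C⊆B = Unique⇒length≤#classes Near C! classify single
      where
      m : Fin n
      m = argmax (λ w → pos w A) c cs

      m∈C : m ∈ c ∷ cs
      m∈C with argmax-sel (λ w → pos w A) c cs
      ... | inj₁ m≡c  = here m≡c
      ... | inj₂ m∈cs = there m∈cs

      m-last : ∀ {w} → w ∈ c ∷ cs → pos w A ≤ pos m A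
      m-last (here refl) = f[⊥]≤f[argmax] {f = λ w → pos w A} c cs
      m-last (there w∈)  = All.lookup (f[xs]≤f[argmax] {f = λ w → pos w A} c cs) w∈

      Near : Fin 4 → Fin n → Set
      Near 0F w = w ≡ m
      Near 1F w = pos m A ≡ suc (pos w A)
      Near 2F w = pos m B ≡ suc (pos w B)
      Near 3F w = pos w B ≡ suc (pos m B)

      classify : ∀ {w} → w ∈ c ∷ cs → ∃ λ i → Near i w
      classify {w} w∈ with w Finₚ.≟ m
      ... | yes w≡m = 0F , w≡m
      ... | no  w≢m with adj G m w in mw
      ... | true with adj⇒pos-adjacent G P-forest (C⊆A m∈C) (C⊆A w∈) mw
      ...   | inj₁ w-after-m = ⊥-elim (<⇒≱ (≤-reflexive (sym w-after-m)) (m-last w∈))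
      ...   | inj₂ m-after-w = 1F , m-after-w
      classify {w} w∈ | no w≢m | false
        with adj⇒pos-adjacent (complement G) Q-forest (C⊆B m∈C) (C⊆B w∈)
               (complement-adj G mw (λ m≡w → w≢m (sym m≡w)))
      ...   | inj₁ w-after-m = 3F , w-after-m
      ...   | inj₂ m-after-w = 2F , m-after-w

      single : ∀ i {w w′} → w ∈ c ∷ cs → w′ ∈ c ∷ cs → Near i w → Near i w′ → w ≡ w′
      single 0F _  _   w≡m m-w′ = trans w≡m (sym m-w′)
      single 1F w∈ w′∈ e e′ = position-injective _ A (C⊆A w∈) (C⊆A w′∈) (suc-injective (trans (sym e) e′))
      single 2F w∈ w′∈ e e′ = position-injective _ B (C⊆B w∈) (C⊆B w′∈) (suc-injective (trans (sym e) e′))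
      single 3F w∈ w′∈ e e′ = position-injective _ B (C⊆B w∈) (C⊆B w′∈) (trans e (sym e′))

    linearForests-size≤n+4 : length A + length B ≤ n + 4
    linearForests-size≤n+4 = ≤-trans (length+length≤n+common (proj₁ P-forest) (proj₁ Q-forest))
      (+-monoʳ-≤ n (common-length≤4 (filter⁺ _ (proj₁ P-forest))
        (λ x∈ → proj₁ (∈-filter⁻ (_∈? B) x∈)) (λ x∈ → proj₂ (∈-filter⁻ (_∈? B) {xs = A} x∈))))

  spanning-linearForest⇒IsLIF : ∀ (G : Graph n) P → InducesLinearForest G P → length (concat P) ≡ n → IsLIF G n
  spanning-linearForest⇒IsLIF G P P-forest spanning =
    (P , P-forest , spanning) , λ _ Q-forest → Unique⇒length≤ (proj₁ Q-forest)

  inducesLinearForest? : ∀ (G : Graph n) P → Dec (InducesLinearForest G P)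
  inducesLinearForest? G P =
    unique? (concat P) ×-dec
    Finₚ.all? λ u → Finₚ.all? λ v → (u ∈? concat P) →-dec ((v ∈? concat P) →-dec
      ((adj G u v Bool.≟ true) ⇔-dec
       Any.any? (λ p → consecutive? Finₚ._≟_ p u v ⊎-dec consecutive? Finₚ._≟_ p v u) P))
    where
    open DecUnique (Finₚ._≟_ {n}) using (unique?)
    _⇔-dec_ : ∀ {X Y : Set} → Dec X → Dec Y → Dec (X ⇔ Y)
    x? ⇔-dec y? = map′ (uncurry mk⇔) (λ x⇔y → Equivalence.to x⇔y , Equivalence.from x⇔y)
                       ((x? →-dec y?) ×-dec (y? →-dec x?))

path : (n : ℕ) → Graph n
path n = record
  { adj        = λ i j → (suc (toℕ i) ≡ᵇ toℕ j) ∨ (suc (toℕ j) ≡ᵇ toℕ i)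
  ; adj-sym    = λ i j → Bool.∨-comm (suc (toℕ i) ≡ᵇ toℕ j) _
  ; adj-irrefl = λ i → cong (λ b → b ∨ b) (suc≢ᵇ (toℕ i))
  }
  where
  suc≢ᵇ : ∀ k → (suc k ≡ᵇ k) ≡ false
  suc≢ᵇ zero    = refl
  suc≢ᵇ (suc k) = suc≢ᵇ k

path₄-paths complement-path₄-paths : List (List (Fin 4))
path₄-paths            = (# 0 ∷ # 1 ∷ # 2 ∷ # 3 ∷ []) ∷ []
complement-path₄-paths = (# 2 ∷ # 0 ∷ # 3 ∷ # 1 ∷ []) ∷ []

path₄-forest : InducesLinearForest (path 4) path₄-paths
path₄-forest = from-yes (inducesLinearForest? (path 4) path₄-paths)

complement-path₄-forest : InducesLinearForest (complement (path 4)) complement-path₄-paths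
complement-path₄-forest = from-yes (inducesLinearForest? (complement (path 4)) complement-path₄-paths)

mainTheorem5 :
    ((n : ℕ) (G : Graph n) (a b : ℕ) →
       IsLIF G a → IsLIF (complement G) b → a + b ≤ n + 4)
    ×
    (∃ λ n → Σ (Graph n) λ G → ∃ λ a → ∃ λ b →
       IsLIF G a × IsLIF (complement G) b × a + b ≡ n + 4)
mainTheorem5 = upper , sharp
  where
  upper : (n : ℕ) (G : Graph n) (a b : ℕ) → IsLIF G a → IsLIF (complement G) b → a + b ≤ n + 4
  upper _ G _ _ ((_ , P-forest , refl) , _) ((_ , Q-forest , refl) , _) =
    linearForests-size≤n+4 G P-forest Q-forest
  sharp : ∃ λ n → Σ (Graph n) λ G → ∃ λ a → ∃ λ b →
            IsLIF G a × IsLIF (complement G) b × a + b ≡ n + 4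
  sharp = 4 , path 4 , 4 , 4 ,
    spanning-linearForest⇒IsLIF (path 4) path₄-paths path₄-forest refl ,
    spanning-linearForest⇒IsLIF (complement (path 4)) complement-path₄-paths complement-path₄-forest refl , refl
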